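{- Let $G=(V,E)$ be a connected bipartite graph of order $n=r+s\ge 4$ with stable sets $U,W$ such that $V=U\cup W$ and $1\le |U|=r\le s=|W|$. If $\lambda(\overline{G})=\lambda(G)+1$, then $r\le s\le 2^r-1$. Moreover, if $r<s$ then $U$ is the unique LD-code of $G$, and if $r=s$ then one of $U$, $W$ is a non-global LD-code of $G$.
   Context: $\overline{G}$ denotes the complement of $G$. A set $S\subseteq V$ is a locating-dominating set (LD-set) of $G$ if every vertex of $V\setminus S$ has a neighbor in $S$ and for any two distinct $u,v\in V\setminus S$, $N_G(u)\cap S\neq N_G(v)\cap S$. $\lambda(G)$ is the minimum cardinality of an LD-set of $G$; an LD-code is an LD-set of cardinality $\lambda(G)$. An LD-code of $G$ is non-global if it is not an LD-set of $\overline{G}$. -}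

module Defs where

open import Data.Nat using (ℕ; zero; suc; _+_; _≤_)
open import Data.Fin using (Fin)
open import Data.Fin.Subset using (Subset; _∈_; ∣_∣)
open import Data.Product using (Σ; ∃; _×_; _,_)
open import Data.Sum using (_⊎_)
open import Relation.Nullary using (¬_)
open import Relation.Binary.PropositionalEquality using (_≡_; _≢_; ≢-sym)
open import Function.Bundles using (_⇔_)
open import Level using (0ℓ)

record Graph (n : ℕ) : Set₁ where
  field
    Adj   : Fin n → Fin n → Set
    sym   : ∀ {u v} → Adj u v → Adj v u
    irrefl : ∀ {u} → ¬ Adj u u
open Graph public

complement : ∀ {n} → Graph n → Graph n
complement G = record
  { Adj = λ u v → (u ≢ v) × ¬ Adj G u v
  ; sym = λ { (u≢v , ¬a) → ≢-sym u≢v , (λ a → ¬a (sym G a)) }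
  ; irrefl = λ { (u≢u , _) → u≢u _≡_.refl }
  }

data Reach {n : ℕ} (G : Graph n) : Fin n → Fin n → Set where
  here : ∀ {u} → Reach G u u
  step : ∀ {u v w} → Adj G u v → Reach G v w → Reach G u w

Connected : ∀ {n} → Graph n → Set
Connected G = ∀ u v → Reach G u v

Stable : ∀ {n} → Graph n → Subset n → Set
Stable G S = ∀ u v → u ∈ S → v ∈ S → ¬ Adj G u v

IsLDSet : ∀ {n} → Graph n → Subset n → Set
IsLDSet G S =
  (∀ u → ¬ (u ∈ S) → ∃ λ w → w ∈ S × Adj G u w)
  × (∀ u v → ¬ (u ∈ S) → ¬ (v ∈ S) → u ≢ v →
       ¬ (∀ w → w ∈ S → (Adj G u w ⇔ Adj G v w)))

IsLDCode : ∀ {n} → Graph n → Subset n → Set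
IsLDCode G S = IsLDSet G S × (∀ T → IsLDSet G T → ∣ S ∣ ≤ ∣ T ∣)

LDNumber : ∀ {n} → Graph n → ℕ → Set
LDNumber G k = ∃ λ S → IsLDCode G S × ∣ S ∣ ≡ k

IsNonGlobalLDCode : ∀ {n} → Graph n → Subset n → Set
IsNonGlobalLDCode G S = IsLDCode G S × ¬ IsLDSet (complement G) S

module Submission where

open import Defs
open import Data.Nat using (ℕ; suc; _+_; _∸_; _^_; _≤_; _<_)
open import Data.Fin.Subset using (Subset; ∣_∣; ∁)
open import Data.Product using (∃; _×_; _,_)
open import Data.Sum using (_⊎_)
open import Relation.Binary.PropositionalEquality using (_≡_)

open import Data.Nat using (zero; z≤n; s≤s)
open import Data.Nat.Properties
  using ( ≤-trans; ≤-reflexive; ≤-<-trans; <⇒≱; 1+n≰n; n≤1+n; m≤n⇒m<n∨m≡n; <⇒≤pred; _≤?_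
        ; +-suc; +-identityʳ; +-comm; +-mono-≤; +-monoʳ-≤; m∸n≤m; pred[m∸n]≡m∸[1+n]; module ≤-Reasoning)
open import Data.Bool using (Bool; true; false; not)
import Data.Bool as Bool
open import Data.Bool.Properties using (not-involutive)
open import Data.Fin using (Fin; zero; suc; _≟_)
open import Data.Fin.Properties using (any?; all?; suc-injective; ¬∀⟶∃¬)
open import Data.Fin.Subset using (_∈_; _∉_; _∪_; _∩_; _⊆_; _-_; inside; outside; ⊥; ⁅_⁆; Nonempty; Empty)
open import Data.Fin.Subset.Properties
  using ( _∈?_; nonempty?; drop-there; x∈p∪q⁺; x∈p∩q⁺; x∈p∩q⁻; Empty-unique; ∣⊥∣≡0; p⊆q⇒∣p∣≤∣q∣; ⊆-antisym
        ; x∈⁅x⁆; x∈⁅y⁆⇒x≡y; x∉⁅y⁆⇒x≢y; ∣⁅x⁆∣≡1; x∈p∧x≢y⇒x∈p-y; x∈p⇒∣p-x∣<∣p∣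
        ; x∉p⇒x∈∁p; x∈∁p⇒x∉p; x∉∁p⇒x∈p; x∈p⇒x∉∁p)
open import Data.Product using (∃₂; proj₁; proj₂)
open import Data.Sum using (inj₁; inj₂)
import Data.Sum as Sum
open import Data.Vec using ([]; _∷_; tabulate; map; here; there)
open import Data.Vec.Properties using (lookup∘tabulate; []=⇒lookup; lookup⇒[]=; map-∘; map-cong; map-id; ≡-dec)
open import Data.Empty using (⊥-elim)
open import Function using (_∘_; id; case_of_)
open import Function.Bundles using (_⇔_; mk⇔; Equivalence)
open import Relation.Nullary using (¬_; Dec; yes; no; does; contradiction)
open import Relation.Nullary.Decidable
  using (¬?; _×-dec_; _⊎-dec_; _→-dec_; decidable-stable; dec-true; dec-false; does-⇔; ¬¬-excluded-middle)
open import Relation.Binary.PropositionalEquality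
  using (_≢_; _≗_; refl; trans; cong; subst; subst₂; module ≡-Reasoning) renaming (sym to ≡-sym)

-- Write W = ∁ U and Ḡ for the complement of G. The hypothesis λ(Ḡ) = λ(G) + 1
-- says that every LD-code of G is non-global and that Ḡ has no LD-set of size ≤ λ(G) (GapOne).
-- (1) A non-global LD-set S of G has a vertex u ∉ S adjacent to all of S (universal-vertex);
--     in a bipartite graph this forces S to be a side, U or W (non-global⇒side).
-- (2) If U is an LD-set, the vertices of W have distinct nonempty neighbourhoods in U, so
--     ∣ W ∣ ≤ 2 ^ ∣ U ∣ ∸ 1 (side-bound, resting on the counting bound rows-bound-nonzero);
--     symmetrically when W is the LD-set and both sides have equal size (balanced-bound).
-- (3) If ∣ U ∣ < ∣ W ∣ and W were an LD-code, Bondy's theorem on the critical coordinates of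
--     distinct Boolean rows (bondy) yields w ∈ W whose removal keeps the rows of U apart;
--     swapping w for a vertex u ∈ U adjacent to all of W gives an LD-set of Ḡ of size ≤ λ(G),
--     a contradiction (Bipartite.Exchange). So then U is the unique LD-code.
-- Adjacency is an arbitrary relation, but each conclusion is decidable and adjacency is
-- decidable up to double negation (by-decidable-adjacency), so the argument may assume it.

∣p∪q∣≤∣p∣+∣q∣ : ∀ {n} (p q : Subset n) → ∣ p ∪ q ∣ ≤ ∣ p ∣ + ∣ q ∣
∣p∪q∣≤∣p∣+∣q∣ []            []            = z≤n
∣p∪q∣≤∣p∣+∣q∣ (inside ∷ p)  (inside ∷ q)  = s≤s (≤-trans (∣p∪q∣≤∣p∣+∣q∣ p q) (+-monoʳ-≤ ∣ p ∣ (n≤1+n ∣ q ∣)))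
∣p∪q∣≤∣p∣+∣q∣ (inside ∷ p)  (outside ∷ q) = s≤s (∣p∪q∣≤∣p∣+∣q∣ p q)
∣p∪q∣≤∣p∣+∣q∣ (outside ∷ p) (inside ∷ q)  rewrite +-suc ∣ p ∣ ∣ q ∣ = s≤s (∣p∪q∣≤∣p∣+∣q∣ p q)
∣p∪q∣≤∣p∣+∣q∣ (outside ∷ p) (outside ∷ q) = ∣p∪q∣≤∣p∣+∣q∣ p q

pred-sum : ∀ a b → (a ∸ 1) + (b ∸ 1) ≤ a + b ∸ 1
pred-sum zero    b       = ≤-reflexive refl
pred-sum (suc a) zero    = ≤-reflexive refl
pred-sum (suc a) (suc b) = subst (a + b ≤_) (≡-sym (+-suc a b)) (n≤1+n (a + b))

pred-sum-pos : ∀ {a b} → 1 ≤ a → 1 ≤ b → suc ((a ∸ 1) + (b ∸ 1)) ≤ a + b ∸ 1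
pred-sum-pos {suc a} {suc b} _ _ = ≤-reflexive (≡-sym (+-suc a b))

2^[1+q] : ∀ q → 2 ^ suc q ≡ 2 ^ q + 2 ^ q
2^[1+q] q = cong (2 ^ q +_) (+-identityʳ (2 ^ q))

escape : ∀ {n} (C S : Subset n) → ∣ C ∣ < ∣ S ∣ → ∃ λ w → w ∈ S × w ∉ C
escape C S lt with any? (λ w → (w ∈? S) ×-dec ¬? (w ∈? C))
... | yes found = found
... | no none    = contradiction (p⊆q⇒∣p∣≤∣q∣ S⊆C) (<⇒≱ lt)
  where
  S⊆C : S ⊆ C
  S⊆C {w} w∈S = decidable-stable (w ∈? C) (λ w∉C → none (w , w∈S , w∉C))

∣Empty∣≡0 : ∀ {n} {p : Subset n} → Empty p → ∣ p ∣ ≡ 0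
∣Empty∣≡0 {n} empty = trans (cong ∣_∣ (Empty-unique empty)) (∣⊥∣≡0 n)

∣Nonempty∣≥1 : ∀ {n} {p : Subset n} → Nonempty p → 1 ≤ ∣ p ∣
∣Nonempty∣≥1 {p = p} (x , x∈p) = subst (_≤ ∣ p ∣) (∣⁅x⁆∣≡1 x) (p⊆q⇒∣p∣≤∣q∣ ⁅x⁆⊆p)
  where
  ⁅x⁆⊆p : ⁅ x ⁆ ⊆ p
  ⁅x⁆⊆p y∈⁅x⁆ = subst (_∈ p) (≡-sym (x∈⁅y⁆⇒x≡y x y∈⁅x⁆)) x∈p

∣subsingleton∣≤1 : ∀ {n} (p : Subset n) → (∀ x y → x ∈ p → y ∈ p → x ≡ y) → ∣ p ∣ ≤ 1
∣subsingleton∣≤1 p unique with nonempty? p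
... | no empty       = subst (_≤ 1) (≡-sym (∣Empty∣≡0 empty)) z≤n
... | yes (x , x∈p)  = subst (∣ p ∣ ≤_) (∣⁅x⁆∣≡1 x) (p⊆q⇒∣p∣≤∣q∣ p⊆⁅x⁆)
  where
  p⊆⁅x⁆ : p ⊆ ⁅ x ⁆
  p⊆⁅x⁆ {y} y∈p = subst (_∈ ⁅ x ⁆) (unique x y x∈p y∈p) (x∈⁅x⁆ x)

part : ∀ {n} → Subset n → (Fin n → Bool) → Bool → Subset n
part P h b = P ∩ tabulate (λ i → does (h i Bool.≟ b))

∈part⁺ : ∀ {n} {P : Subset n} {h b i} → i ∈ P → h i ≡ b → i ∈ part P h b
∈part⁺ {h = h} {b} {i} i∈P hi≡b =
  x∈p∩q⁺ (i∈P , lookup⇒[]= i _ (trans (lookup∘tabulate _ i) (dec-true (h i Bool.≟ b) hi≡b)))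

∈part⁻ : ∀ {n} {P : Subset n} {h b i} → i ∈ part P h b → i ∈ P × h i ≡ b
∈part⁻ {P = P} {h} {b} {i} i∈part with x∈p∩q⁻ P _ i∈part
... | i∈P , i∈test = i∈P , does-true (h i Bool.≟ b) (trans (≡-sym (lookup∘tabulate _ i)) ([]=⇒lookup i∈test))
  where
  does-true : ∀ {A : Set} (a? : Dec A) → does a? ≡ true → A
  does-true (yes a) _ = a

part-size : ∀ {n} (P : Subset n) h → ∣ P ∣ ≡ ∣ part P h true ∣ + ∣ part P h false ∣
part-size []            h = refl
part-size (outside ∷ P) h = part-size P (λ i → h (suc i))
part-size (inside ∷ P)  h with h zero
... | true  = cong suc (part-size P (λ i → h (suc i)))
... | false = trans (cong suc (part-size P (λ i → h (suc i)))) (≡-sym (+-suc _ _))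

Rows : ℕ → ℕ → Set
Rows n d = Fin n → Fin d → Bool

Separated : ∀ {n d} → Subset n → Rows n d → Set
Separated P F = ∀ i j → i ∈ P → j ∈ P → i ≢ j → ¬ (F i ≗ F j)

Critical : ∀ {n d} → Subset n → Rows n d → Fin d → Set
Critical P F c = ∃₂ λ i j → i ∈ P × j ∈ P × ¬ (F i ≗ F j) × (∀ c′ → c′ ≢ c → F i c′ ≡ F j c′)

SupportedIn : ∀ {n d} → Subset n → Subset d → Rows n d → Set
SupportedIn P Q F = ∀ i → i ∈ P → ∀ c → F i c ≡ true → c ∈ Q

NonzeroRows : ∀ {n d} → Subset n → Rows n d → Set
NonzeroRows P F = ∀ i → i ∈ P → ∃ λ c → F i c ≡ true

-- Splitting the rows of P by their first coordinate: the induction step of both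
-- Bondy's theorem and the counting bound below.
module FirstCoordinate {n d} (P : Subset n) (F : Rows n (suc d)) where

  half : Bool → Subset n
  half = part P (λ i → F i zero)

  rest : Rows n d
  rest i c = F i (suc c)

  ∈half⁺ : ∀ {i b} → i ∈ P → F i zero ≡ b → i ∈ half b
  ∈half⁺ = ∈part⁺ {h = λ i → F i zero}

  ∈half⁻ : ∀ {i b} → i ∈ half b → i ∈ P × F i zero ≡ b
  ∈half⁻ = ∈part⁻ {h = λ i → F i zero}

  halves-size : ∣ P ∣ ≡ ∣ half true ∣ + ∣ half false ∣
  halves-size = part-size P (λ i → F i zero)

  rows-agree : ∀ {i j} → F i zero ≡ F j zero → rest i ≗ rest j → F i ≗ F j
  rows-agree same-first same-rest zero    = same-first
  rows-agree same-first same-rest (suc c) = same-rest c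

  separated-half : Separated P F → ∀ b → Separated (half b) rest
  separated-half sep b i j i∈ j∈ i≢j same-rest with ∈half⁻ i∈ | ∈half⁻ j∈
  ... | i∈P , Fi≡b | j∈P , Fj≡b = sep i j i∈P j∈P i≢j (rows-agree (trans Fi≡b (≡-sym Fj≡b)) same-rest)

  supported-half : ∀ {s Q} → SupportedIn P (s ∷ Q) F → ∀ b → SupportedIn (half b) Q rest
  supported-half supp b i i∈ c Fic = drop-there (supp i (proj₁ (∈half⁻ i∈)) (suc c) Fic)

  unsupported-first : ∀ {Q} → SupportedIn P (outside ∷ Q) F → ∣ half true ∣ ≡ 0
  unsupported-first supp = ∣Empty∣≡0 λ where
    (i , i∈) → case supp i (proj₁ (∈half⁻ i∈)) zero (proj₂ (∈half⁻ i∈)) of λ ()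

  nonzero-half : NonzeroRows P F → NonzeroRows (half false) rest
  nonzero-half nz i i∈ with ∈half⁻ i∈
  ... | i∈P , Fi0≡false with nz i i∈P
  ... | zero  , Fi0≡true = case trans (≡-sym Fi0≡false) Fi0≡true of λ ()
  ... | suc c , Fic≡true = c , Fic≡true

  critical-rest : ∀ {c} → Critical P F (suc c) → ∃ λ b → Critical (half b) rest c
  critical-rest (i , j , i∈P , j∈P , differ , agree) =
    F i zero , i , j , ∈half⁺ i∈P refl , ∈half⁺ j∈P (≡-sym same-first) ,
    (λ same-rest → differ (rows-agree same-first same-rest)) , λ c′ c′≢c → agree (suc c′) (c′≢c ∘ suc-injective)
    where
    same-first : F i zero ≡ F j zero
    same-first = agree zero λ ()

  critical-first : Critical P F zero → Nonempty (half true) × Nonempty (half false)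
  critical-first (i , j , i∈P , j∈P , differ , agree) with F i zero in Fi0 | F j zero in Fj0
  ... | true  | false = (i , ∈half⁺ i∈P Fi0) , (j , ∈half⁺ j∈P Fj0)
  ... | false | true  = (j , ∈half⁺ j∈P Fj0) , (i , ∈half⁺ i∈P Fi0)
  ... | true  | true  = ⊥-elim (differ (rows-agree (trans Fi0 (≡-sym Fj0)) λ c → agree (suc c) λ ()))
  ... | false | false = ⊥-elim (differ (rows-agree (trans Fi0 (≡-sym Fj0)) λ c → agree (suc c) λ ()))

CriticalCover : ∀ {n d} → Subset n → Rows n d → Subset d → Set
CriticalCover P F C = ∣ C ∣ ≤ ∣ P ∣ ∸ 1 × (∀ c → Critical P F c → c ∈ C)

-- Splitting by the first coordinate, the covers of the two halves are merged, and
-- the first coordinate itself is added only when both halves are nonempty.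
bondy : ∀ {n} d (P : Subset n) (F : Rows n d) → ∃ (CriticalCover P F)
bondy zero    P F = [] , z≤n , λ ()
bondy (suc d) P F = merge (nonempty? (half true) ×-dec nonempty? (half false))
  where
  open FirstCoordinate P F

  cover : ∀ b → ∃ (CriticalCover (half b) rest)
  cover b = bondy d (half b) rest

  C₁ C₀ : Subset d
  C₁ = proj₁ (cover true)
  C₀ = proj₁ (cover false)

  union-size : ∣ C₁ ∪ C₀ ∣ ≤ (∣ half true ∣ ∸ 1) + (∣ half false ∣ ∸ 1)
  union-size = ≤-trans (∣p∪q∣≤∣p∣+∣q∣ C₁ C₀)
                       (+-mono-≤ (proj₁ (proj₂ (cover true))) (proj₁ (proj₂ (cover false))))

  covers-rest : ∀ c → Critical P F (suc c) → c ∈ C₁ ∪ C₀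
  covers-rest c critical with critical-rest critical
  ... | true  , critical′ = x∈p∪q⁺ (inj₁ (proj₂ (proj₂ (cover true)) c critical′))
  ... | false , critical′ = x∈p∪q⁺ (inj₂ (proj₂ (proj₂ (cover false)) c critical′))

  bound : ∀ {m} → m ≤ ∣ half true ∣ + ∣ half false ∣ ∸ 1 → m ≤ ∣ P ∣ ∸ 1
  bound {m} = subst (m ≤_) (cong (_∸ 1) (≡-sym halves-size))

  merge : Dec (Nonempty (half true) × Nonempty (half false)) → ∃ (CriticalCover P F)
  merge (yes (ne₁ , ne₀)) =
    inside ∷ (C₁ ∪ C₀) ,
    bound (≤-trans (s≤s union-size) (pred-sum-pos (∣Nonempty∣≥1 ne₁) (∣Nonempty∣≥1 ne₀))) ,
    λ { zero _ → here ; (suc c) critical → there (covers-rest c critical) }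
  merge (no ¬both) =
    outside ∷ (C₁ ∪ C₀) ,
    bound (≤-trans union-size (pred-sum ∣ half true ∣ ∣ half false ∣)) ,
    λ { zero critical → ⊥-elim (¬both (critical-first critical))
      ; (suc c) critical → there (covers-rest c critical) }

non-critical-coordinate : ∀ {n d} (P : Subset n) (Q : Subset d) (F : Rows n d) →
                          ∣ P ∣ ∸ 1 < ∣ Q ∣ → ∃ λ c → c ∈ Q × ¬ Critical P F c
non-critical-coordinate {d = d} P Q F large with bondy d P F
... | C , size , covers with escape C Q (≤-<-trans size large)
... | c , c∈Q , c∉C = c , c∈Q , c∉C ∘ covers c

-- Both go by splitting on the first
-- coordinate; a coordinate outside Q leaves the first half empty.
rows-bound : ∀ {n} d (P : Subset n) (Q : Subset d) (F : Rows n d) →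
             Separated P F → SupportedIn P Q F → ∣ P ∣ ≤ 2 ^ ∣ Q ∣
rows-bound zero P [] F sep supp = ∣subsingleton∣≤1 P λ i j i∈P j∈P → decidable-stable (i ≟ j)
  λ i≢j → sep i j i∈P j∈P i≢j λ ()
rows-bound (suc d) P (inside ∷ Q) F sep supp = begin
  ∣ P ∣                           ≡⟨ halves-size ⟩
  ∣ half true ∣ + ∣ half false ∣ ≤⟨ +-mono-≤ (bound-half true) (bound-half false) ⟩
  2 ^ ∣ Q ∣ + 2 ^ ∣ Q ∣           ≡⟨ 2^[1+q] ∣ Q ∣ ⟨
  2 ^ suc ∣ Q ∣                   ∎
  where
  open FirstCoordinate P F
  open ≤-Reasoning
  bound-half : ∀ b → ∣ half b ∣ ≤ 2 ^ ∣ Q ∣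
  bound-half b = rows-bound d (half b) Q rest (separated-half sep b) (supported-half supp b)
rows-bound (suc d) P (outside ∷ Q) F sep supp = begin
  ∣ P ∣                           ≡⟨ halves-size ⟩
  ∣ half true ∣ + ∣ half false ∣ ≡⟨ cong (_+ ∣ half false ∣) (unsupported-first supp) ⟩
  ∣ half false ∣                  ≤⟨ rows-bound d (half false) Q rest (separated-half sep false)
                                                (supported-half supp false) ⟩
  2 ^ ∣ Q ∣                       ∎
  where
  open FirstCoordinate P F
  open ≤-Reasoning

rows-bound-nonzero : ∀ {n} d (P : Subset n) (Q : Subset d) (F : Rows n d) →
                     Separated P F → SupportedIn P Q F → NonzeroRows P F → suc ∣ P ∣ ≤ 2 ^ ∣ Q ∣
rows-bound-nonzero zero P [] F sep supp nz =
  s≤s (≤-reflexive (∣Empty∣≡0 λ { (i , i∈P) → case nz i i∈P of λ () }))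
rows-bound-nonzero (suc d) P (inside ∷ Q) F sep supp nz = begin
  suc ∣ P ∣                             ≡⟨ cong suc halves-size ⟩
  suc (∣ half true ∣ + ∣ half false ∣) ≡⟨ +-suc ∣ half true ∣ ∣ half false ∣ ⟨
  ∣ half true ∣ + suc ∣ half false ∣   ≤⟨ +-mono-≤ (rows-bound d (half true) Q rest (separated-half sep true)
                                                               (supported-half supp true))
                                                   (bound-half-false nz) ⟩
  2 ^ ∣ Q ∣ + 2 ^ ∣ Q ∣                 ≡⟨ 2^[1+q] ∣ Q ∣ ⟨
  2 ^ suc ∣ Q ∣                         ∎
  where
  open FirstCoordinate P F
  open ≤-Reasoning
  bound-half-false : NonzeroRows P F → suc ∣ half false ∣ ≤ 2 ^ ∣ Q ∣
  bound-half-false nz = rows-bound-nonzero d (half false) Q rest (separated-half sep false)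
                                           (supported-half supp false) (nonzero-half nz)
rows-bound-nonzero (suc d) P (outside ∷ Q) F sep supp nz = begin
  suc ∣ P ∣                             ≡⟨ cong suc halves-size ⟩
  suc (∣ half true ∣ + ∣ half false ∣) ≡⟨ cong (λ m → suc (m + ∣ half false ∣)) (unsupported-first supp) ⟩
  suc ∣ half false ∣                    ≤⟨ rows-bound-nonzero d (half false) Q rest (separated-half sep false)
                                                             (supported-half supp false) (nonzero-half nz) ⟩
  2 ^ ∣ Q ∣                             ∎
  where
  open FirstCoordinate P F
  open ≤-Reasoning

Dominating : ∀ {n} → Graph n → Subset n → Set
Dominating G S = ∀ u → u ∉ S → ∃ λ w → w ∈ S × Adj G u w

Locating : ∀ {n} → Graph n → Subset n → Set
Locating G S = ∀ u v → u ∉ S → v ∉ S → u ≢ v → ¬ (∀ w → w ∈ S → (Adj G u w ⇔ Adj G v w))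

DecidableAdjacency : ∀ {n} → Graph n → Set
DecidableAdjacency {n} G = (u v : Fin n) → Dec (Adj G u v)

∁-involutive : ∀ {n} (p : Subset n) → ∁ (∁ p) ≡ p
∁-involutive p = begin
  map not (map not p) ≡⟨ map-∘ not not p ⟨
  map (not ∘ not) p   ≡⟨ map-cong not-involutive p ⟩
  map id p            ≡⟨ map-id p ⟩
  p                   ∎
  where open ≡-Reasoning

module WithDecidableAdjacency {n} (G : Graph n) (D : DecidableAdjacency G) where

  Ḡ : Graph n
  Ḡ = complement G

  adj : Rows n n
  adj u v = does (D u v)

  adj⁺ : ∀ {u v} → Adj G u v → adj u v ≡ true
  adj⁺ {u} {v} = dec-true (D u v)

  adj⁻ : ∀ {u v} → adj u v ≡ true → Adj G u v
  adj⁻ {u} {v} _ with D u v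
  ... | yes a = a

  complement-⇔ : ∀ {u v w} → u ≢ w → v ≢ w → (Adj Ḡ u w ⇔ Adj Ḡ v w) → (Adj G u w ⇔ Adj G v w)
  complement-⇔ {u} {v} {w} u≢w v≢w same =
    mk⇔ (transfer v≢w (Equivalence.from same)) (transfer u≢w (Equivalence.to same))
    where
    transfer : ∀ {x y} → y ≢ w → (Adj Ḡ y w → Adj Ḡ x w) → Adj G x w → Adj G y w
    transfer {y = y} y≢w back a = decidable-stable (D y w) λ ¬b → proj₂ (back (y≢w , ¬b)) a

  locating-complement : ∀ {S} → Locating G S → Locating Ḡ S
  locating-complement loc u v u∉S v∉S u≢v same =
    loc u v u∉S v∉S u≢v λ w w∈S → complement-⇔ (∉⇒≢ u∉S w∈S) (∉⇒≢ v∉S w∈S) (same w w∈S)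
    where
    ∉⇒≢ : ∀ {S x w} → x ∉ S → w ∈ S → x ≢ w
    ∉⇒≢ x∉S w∈S refl = x∉S w∈S

  locating⇒separated : ∀ {S P} → Locating G S → (∀ i → i ∈ P → i ∉ S) → Separated P adj
  locating⇒separated loc outside-S i j i∈P j∈P i≢j same-row =
    loc i j (outside-S i i∈P) (outside-S j j∈P) i≢j λ w _ →
      mk⇔ (λ a → adj⁻ (trans (≡-sym (same-row w)) (adj⁺ a))) (λ b → adj⁻ (trans (same-row w) (adj⁺ b)))

  -- An LD-set of G fails to be one of Ḡ only if some vertex outside it is adjacent
  -- to all of it: otherwise it dominates Ḡ, and it locates Ḡ anyway.
  universal-vertex : ∀ {S} → Locating G S → ¬ IsLDSet Ḡ S →
                     ∃ λ u → u ∉ S × (∀ w → w ∈ S → Adj G u w)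
  universal-vertex {S} loc non-global with any? (λ u → ¬? (u ∈? S) ×-dec all? (λ w → (w ∈? S) →-dec D u w))
  ... | yes found = found
  ... | no none   = ⊥-elim (non-global (dominating , locating-complement loc))
    where
    dominating : Dominating Ḡ S
    dominating u u∉S with any? (λ w → (w ∈? S) ×-dec ¬? (D u w))
    ... | yes (w , w∈S , ¬a) = w , w∈S , (λ { refl → u∉S w∈S }) , ¬a
    ... | no  ¬missing       = ⊥-elim (none (u , u∉S , λ w w∈S →
                                 decidable-stable (D u w) λ ¬a → ¬missing (w , w∈S , ¬a)))

  -- If A is an LD-set whose complement is stable, the vertices outside A have distinct,
  -- nonempty neighbourhoods inside A, so there are fewer than 2 ^ ∣ A ∣ of them.
  side-bound : ∀ {A} → IsLDSet G A → Stable G (∁ A) → suc ∣ ∁ A ∣ ≤ 2 ^ ∣ A ∣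
  side-bound {A} (dom , loc) stable =
    rows-bound-nonzero n (∁ A) A adj (locating⇒separated loc λ _ → x∈∁p⇒x∉p) supported nonzero
    where
    supported : SupportedIn (∁ A) A adj
    supported i i∈∁A c row = decidable-stable (c ∈? A) λ c∉A → stable i c i∈∁A (x∉p⇒x∈∁p c∉A) (adj⁻ row)

    nonzero : NonzeroRows (∁ A) adj
    nonzero i i∈∁A = let (w , _ , a) = dom i (x∈∁p⇒x∉p i∈∁A) in w , adj⁺ a

-- In a graph with bipartition (A, ∁ A), a dominating set S all of whose members are
-- adjacent to a vertex of A is the side ∁ A: S avoids A since A is stable, and a vertex
-- of ∁ A outside S would be dominated from within ∁ A, which is stable too.
universal⇒other-side : ∀ {n} (G : Graph n) {A S : Subset n} {u} → Stable G A → Stable G (∁ A) →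
                       Dominating G S → u ∈ A → (∀ w → w ∈ S → Adj G u w) → S ≡ ∁ A
universal⇒other-side G {A} {S} {u} stable-A stable-∁A dom u∈A universal = ⊆-antisym S⊆∁A ∁A⊆S
  where
  S⊆∁A : S ⊆ ∁ A
  S⊆∁A {x} x∈S = x∉p⇒x∈∁p λ x∈A → stable-A u x u∈A x∈A (universal x x∈S)

  ∁A⊆S : ∁ A ⊆ S
  ∁A⊆S {x} x∈∁A = decidable-stable (x ∈? S) λ x∉S →
    let (w , w∈S , a) = dom x x∉S in stable-∁A x w x∈∁A (S⊆∁A w∈S) a

module Bipartite {n} (G : Graph n) (D : DecidableAdjacency G) (U : Subset n)
                 (stable-U : Stable G U) (stable-W : Stable G (∁ U)) where
  open WithDecidableAdjacency G D

  stable-∁∁U : Stable G (∁ (∁ U))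
  stable-∁∁U = subst (Stable G) (≡-sym (∁-involutive U)) stable-U

  non-global⇒side : ∀ {S} → IsLDSet G S → ¬ IsLDSet Ḡ S → S ≡ U ⊎ S ≡ ∁ U
  non-global⇒side (dom , loc) non-global with universal-vertex loc non-global
  ... | u , _ , universal with u ∈? U
  ... | yes u∈U = inj₂ (universal⇒other-side G stable-U stable-W dom u∈U universal)
  ... | no  u∉U = inj₁ (trans (universal⇒other-side G stable-W stable-∁∁U dom (x∉p⇒x∈∁p u∉U) universal)
                              (∁-involutive U))

  balanced-bound : IsLDSet G (∁ U) → ∣ U ∣ ≡ ∣ ∁ U ∣ → suc ∣ ∁ U ∣ ≤ 2 ^ ∣ U ∣
  balanced-bound ld-W balanced =
    subst₂ (λ a b → suc a ≤ 2 ^ b) (trans (cong ∣_∣ (∁-involutive U)) balanced) (≡-sym balanced)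
           (side-bound ld-W stable-∁∁U)

  -- Suppose the larger side W = ∁ U is an LD-set of G but not of Ḡ.
  -- Take u₀ ∈ U adjacent to all of W and, by Bondy's theorem, w ∈ W such that the rows of
  -- U stay pairwise different off coordinate w. Then T = (W - w) ∪ ⁅ u₀ ⁆ is an LD-set of
  -- Ḡ with at most ∣ W ∣ elements.
  module Exchange (ld-W : IsLDSet G (∁ U)) (non-global : ¬ IsLDSet Ḡ (∁ U))
                  (U-nonempty : 1 ≤ ∣ U ∣) (U<W : ∣ U ∣ < ∣ ∁ U ∣) where

    W : Subset n
    W = ∁ U

    universal₀ : ∃ λ u → u ∉ W × (∀ w → w ∈ W → Adj G u w)
    universal₀ = universal-vertex (proj₂ ld-W) non-global

    u₀ : Fin n
    u₀ = proj₁ universal₀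

    u₀∈U : u₀ ∈ U
    u₀∈U = x∉∁p⇒x∈p (proj₁ (proj₂ universal₀))

    u₀-adj : ∀ w → w ∈ W → Adj G u₀ w
    u₀-adj = proj₂ (proj₂ universal₀)

    chosen : ∃ λ w → w ∈ W × ¬ Critical U adj w
    chosen = non-critical-coordinate U W adj (≤-<-trans (m∸n≤m ∣ U ∣ 1) U<W)

    w : Fin n
    w = proj₁ chosen

    w∈W : w ∈ W
    w∈W = proj₁ (proj₂ chosen)

    other : ∃ λ y → y ∈ W × y ∉ ⁅ w ⁆
    other = escape ⁅ w ⁆ W (subst (_< ∣ W ∣) (≡-sym (∣⁅x⁆∣≡1 w)) (≤-<-trans U-nonempty U<W))

    T : Subset n
    T = (W - w) ∪ ⁅ u₀ ⁆

    T-size : ∣ T ∣ ≤ ∣ W ∣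
    T-size = begin
      ∣ T ∣                   ≤⟨ ∣p∪q∣≤∣p∣+∣q∣ (W - w) ⁅ u₀ ⁆ ⟩
      ∣ W - w ∣ + ∣ ⁅ u₀ ⁆ ∣ ≡⟨ cong (∣ W - w ∣ +_) (∣⁅x⁆∣≡1 u₀) ⟩
      ∣ W - w ∣ + 1           ≡⟨ +-comm ∣ W - w ∣ 1 ⟩
      suc ∣ W - w ∣           ≤⟨ x∈p⇒∣p-x∣<∣p∣ w∈W ⟩
      ∣ W ∣                   ∎
      where open ≤-Reasoning

    u₀∈T : u₀ ∈ T
    u₀∈T = x∈p∪q⁺ (inj₂ (x∈⁅x⁆ u₀))

    W∈T : ∀ {x} → x ∈ W → x ≢ w → x ∈ T
    W∈T x∈W x≢w = x∈p∪q⁺ (inj₁ (x∈p∧x≢y⇒x∈p-y x∈W x≢w))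

    outside-T : ∀ x → x ∉ T → x ≢ u₀ × (x ≡ w ⊎ x ∈ U)
    outside-T x x∉T = (λ { refl → x∉T u₀∈T }) , side
      where
      side : x ≡ w ⊎ x ∈ U
      side with x ≟ w | x ∈? U
      ... | yes x≡w | _       = inj₁ x≡w
      ... | no  _   | yes x∈U = inj₂ x∈U
      ... | no  x≢w | no  x∉U = ⊥-elim (x∉T (W∈T (x∉p⇒x∈∁p x∉U) x≢w))

    differ-off-w : ∀ {x y} → x ∈ U → y ∈ U → x ≢ y → ∃ λ c → c ∈ W × c ≢ w × adj x c ≢ adj y c
    differ-off-w {x} {y} x∈U y∈U x≢y
      with ¬∀⟶∃¬ n (λ c → c ≢ w → adj x c ≡ adj y c) (λ c → ¬? (c ≟ w) →-dec (adj x c Bool.≟ adj y c))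
                 (λ agree → proj₂ (proj₂ chosen) (x , y , x∈U , y∈U , rows-differ , agree))
      where
      rows-differ : ¬ (adj x ≗ adj y)
      rows-differ = locating⇒separated (proj₂ ld-W) (λ _ → x∈p⇒x∉∁p) x y x∈U y∈U x≢y
    ... | c , ¬agree = c , c∈W , (λ c≡w → ¬agree λ c≢w → ⊥-elim (c≢w c≡w)) , (λ same → ¬agree λ _ → same)
      where
      -- Inside the stable side U both rows vanish.
      c∈W : c ∈ W
      c∈W = x∉p⇒x∈∁p λ c∈U → ¬agree λ _ →
        trans (dec-false (D x c) (stable-U x c x∈U c∈U)) (≡-sym (dec-false (D y c) (stable-U y c y∈U c∈U)))

    dominating-T : Dominating Ḡ T
    dominating-T x x∉T with outside-T x x∉T
    ... | x≢u₀ , inj₂ x∈U  = u₀ , u₀∈T , x≢u₀ , stable-U x u₀ x∈U u₀∈U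
    ... | _    , inj₁ refl with other
    ... | y , y∈W , y∉⁅w⁆ =
      y , W∈T y∈W (x∉⁅y⁆⇒x≢y y∉⁅w⁆) , (λ { refl → y∉⁅w⁆ (x∈⁅x⁆ x) }) , stable-W x y w∈W y∈W

    u₀-separates-w : ∀ {y} → y ∈ U → y ≢ u₀ → ¬ (Adj Ḡ y u₀ → Adj Ḡ w u₀)
    u₀-separates-w y∈U y≢u₀ to-w = proj₂ (to-w (y≢u₀ , stable-U _ u₀ y∈U u₀∈U)) (Graph.sym G (u₀-adj w w∈W))

    locating-T : Locating Ḡ T
    locating-T x y x∉T y∉T x≢y same with outside-T x x∉T | outside-T y y∉T
    ... | _ , inj₁ x≡w | _ , inj₁ y≡w = x≢y (trans x≡w (≡-sym y≡w))
    ... | _ , inj₁ refl | y≢u₀ , inj₂ y∈U = u₀-separates-w y∈U y≢u₀ (Equivalence.from (same u₀ u₀∈T))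
    ... | x≢u₀ , inj₂ x∈U | _ , inj₁ refl = u₀-separates-w x∈U x≢u₀ (Equivalence.to (same u₀ u₀∈T))
    ... | _ , inj₂ x∈U | _ , inj₂ y∈U with differ-off-w x∈U y∈U x≢y
    ... | c , c∈W , c≢w , rows-differ =
      rows-differ (does-⇔ (complement-⇔ (U≢W x∈U) (U≢W y∈U) (same c (W∈T c∈W c≢w))) (D x c) (D y c))
      where
      U≢W : ∀ {v} → v ∈ U → v ≢ c
      U≢W v∈U refl = x∈p⇒x∉∁p v∈U c∈W

    result : ∃ λ T → IsLDSet Ḡ T × ∣ T ∣ ≤ ∣ ∁ U ∣
    result = T , (dominating-T , locating-T) , T-size

-- Adjacency in a finite graph is decidable up to double negation, so a decidable
-- statement may be proved assuming decidable adjacency.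
¬¬-∀-Fin : ∀ m {P : Fin m → Set} → (∀ i → ¬ ¬ P i) → ¬ ¬ (∀ i → P i)
¬¬-∀-Fin zero    _     all = all λ ()
¬¬-∀-Fin (suc m) ¬¬P   all =
  ¬¬P zero λ P₀ → ¬¬-∀-Fin m (¬¬P ∘ suc) λ Pₛ → all λ { zero → P₀ ; (suc i) → Pₛ i }

¬¬-decidable-adjacency : ∀ {n} (G : Graph n) → ¬ ¬ DecidableAdjacency G
¬¬-decidable-adjacency {n} G = ¬¬-∀-Fin n λ u → ¬¬-∀-Fin n λ v → ¬¬-excluded-middle

by-decidable-adjacency : ∀ {n} (G : Graph n) {A : Set} → Dec A → (DecidableAdjacency G → A) → A
by-decidable-adjacency G A? proof = decidable-stable A? λ ¬A → ¬¬-decidable-adjacency G (¬A ∘ proof)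

module GapOne {n} {G : Graph n} {k} (λG : LDNumber G k) (λḠ : LDNumber (complement G) (suc k)) where

  complement-large : ∀ {T} → IsLDSet (complement G) T → ¬ ∣ T ∣ ≤ k
  complement-large {T} ld small =
    let (_ , (_ , minimal) , size) = λḠ in 1+n≰n (≤-trans (subst (_≤ ∣ T ∣) size (minimal T ld)) small)

  code-size : ∀ {S} → IsLDCode G S → ∣ S ∣ ≤ k
  code-size {S} (_ , minimal) =
    let (S₀ , (ld₀ , _) , size) = λG in subst (∣ S ∣ ≤_) size (minimal S₀ ld₀)

  code-non-global : ∀ {S} → IsLDCode G S → ¬ IsLDSet (complement G) S
  code-non-global code ld = complement-large ld (code-size code)

module BipartiteGapOne {n} (G : Graph n) (U : Subset n) (stable-U : Stable G U) (stable-W : Stable G (∁ U))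
                       (U-nonempty : 1 ≤ ∣ U ∣) {k} (λG : LDNumber G k) (λḠ : LDNumber (complement G) (suc k)) where
  open GapOne {G = G} λG λḠ public
  module B D = Bipartite G D U stable-U stable-W

  -- Every LD-code is a side, but by the exchange argument never the strictly larger one.
  code-side : ∀ S → IsLDCode G S → S ≡ U ⊎ S ≡ ∁ U
  code-side S code = by-decidable-adjacency G (≡-dec Bool._≟_ S U ⊎-dec ≡-dec Bool._≟_ S (∁ U)) λ D →
    B.non-global⇒side D (proj₁ code) (code-non-global code)

  larger-not-code : ∣ U ∣ < ∣ ∁ U ∣ → ¬ IsLDCode G (∁ U)
  larger-not-code U<W code = by-decidable-adjacency G (no id) λ D →
    let (T , ld , size) = B.Exchange.result D (proj₁ code) (code-non-global code) U-nonempty U<W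
    in complement-large ld (≤-trans size (code-size code))

  unique-code : ∣ U ∣ < ∣ ∁ U ∣ → ∀ S → IsLDCode G S → S ≡ U
  unique-code U<W S code with code-side S code
  ... | inj₁ S≡U  = S≡U
  ... | inj₂ refl = ⊥-elim (larger-not-code U<W code)

  -- An LD-code bounds the other side: it is U, or it is ∁ U with both sides of equal size.
  W-bound : ∀ {S} → IsLDCode G S → ∣ U ∣ ≤ ∣ ∁ U ∣ → ∣ ∁ U ∣ ≤ 2 ^ ∣ U ∣ ∸ 1
  W-bound {S} code U≤W = subst (∣ ∁ U ∣ ≤_) (pred[m∸n]≡m∸[1+n] (2 ^ ∣ U ∣) 0)
                               (<⇒≤pred (by-decidable-adjacency G (suc ∣ ∁ U ∣ ≤? 2 ^ ∣ U ∣) bound))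
    where
    bound : DecidableAdjacency G → suc ∣ ∁ U ∣ ≤ 2 ^ ∣ U ∣
    bound D with code-side S code | m≤n⇒m<n∨m≡n U≤W
    ... | inj₁ refl | _             = WithDecidableAdjacency.side-bound G D (proj₁ code) stable-W
    ... | inj₂ refl | inj₂ balanced = B.balanced-bound D (proj₁ code) balanced
    ... | inj₂ refl | inj₁ U<W      = ⊥-elim (larger-not-code U<W code)

corollary4p2 : ∀ {n : ℕ} (G : Graph n) (U : Subset n) →
    4 ≤ n → Connected G → Stable G U → Stable G (∁ U) →
    1 ≤ ∣ U ∣ → ∣ U ∣ ≤ ∣ ∁ U ∣ →
    (∃ λ k → LDNumber G k × LDNumber (complement G) (suc k)) →
    (∣ U ∣ ≤ ∣ ∁ U ∣ × ∣ ∁ U ∣ ≤ 2 ^ ∣ U ∣ ∸ 1)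
    × (∣ U ∣ < ∣ ∁ U ∣ → IsLDCode G U × (∀ S → IsLDCode G S → S ≡ U))
    × (∣ U ∣ ≡ ∣ ∁ U ∣ → IsNonGlobalLDCode G U ⊎ IsNonGlobalLDCode G (∁ U))
corollary4p2 G U _ _ stable-U stable-W U-nonempty U≤W (k , λG@(S₀ , code₀ , _) , λḠ) =
  (U≤W , W-bound code₀ U≤W) ,
  (λ U<W → subst (IsLDCode G) (unique-code U<W S₀ code₀) code₀ , unique-code U<W) ,
  (λ _ → Sum.map non-global-code non-global-code (code-side S₀ code₀))
  where
  open BipartiteGapOne G U stable-U stable-W U-nonempty λG λḠ

  non-global-code : ∀ {S} → S₀ ≡ S → IsNonGlobalLDCode G S
  non-global-code refl = code₀ , code-non-global code₀
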